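{- For every $S\subseteq V$ with $2\le|S|\le n-2$, $x(\delta(S))\ge 2$.
   Context: Setting: $n\ge3$, $V=[n]$ with arithmetic mod $n$, $d=\lfloor n/2\rfloor$; a symmetric circulant instance with stripe costs $c_1,\dots,c_d$. $\phi$ is a permutation of $[d]$ with $c_{\phi(1)}\le\dots\le c_{\phi(d)}$; $g_0=n$, $g_i=\gcd(\phi(i),g_{i-1})$; $\ell=\min\{i:g_i=1\}$; standing assumption $g_0>g_1>\dots>g_\ell=1$. The graph is viewed as directed: for each $v$ and $k\in[d]$ a directed edge $(v,v+k)$ of length $k$ (for $k=n/2$ both $(v,v+n/2)$ and $(v+n/2,v)$). The weight $x$ of a directed edge of length $\phi(i)$ is $(g_{i-1}-g_i)/n$ if $i<\ell$, $g_{\ell-1}/n$ if $i=\ell$, and $0$ if $i>\ell$. $\delta(S)$ is the set of directed edges with exactly one endpoint in $S$ and $x(F)=\sum_{e\in F}x_e$.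
   Formalization: The stripe costs $c_1,\dots,c_d$ take values in ℚ rather than in the real numbers. -}

module Defs where

open import Data.Nat as ℕ using (ℕ; zero; suc; _∸_; _≡ᵇ_; NonZero; ⌊_/2⌋; _<_; _≤_)
open import Data.Nat.Properties using (<-cmp)
open import Data.Nat.GCD using (gcd)
open import Data.Nat.DivMod using (_mod_)
open import Data.Integer as ℤ using (ℤ; +_)
open import Data.Rational as ℚ using (ℚ; 0ℚ)
open import Data.Fin as Fin using (Fin; toℕ)
open import Data.Fin.Subset using (Subset)
open import Data.Vec using (lookup)
open import Data.Bool using (Bool; true; false; if_then_else_; _xor_)
open import Data.List using (List; []; _∷_; map; upTo; allFin; concatMap; foldr)
open import Relation.Binary.Definitions using (tri<; tri≈; tri>)

half : ℕ → ℕ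
half n = ⌊ n /2⌋

range1 : ℕ → List ℕ
range1 d = map suc (upTo d)

gseq : ℕ → (ℕ → ℕ) → ℕ → ℕ
gseq n φ zero    = n
gseq n φ (suc i) = gcd (φ (suc i)) (gseq n φ i)

-- φ⁻¹ k : the (first) index i ∈ [d] with φ i = k  (0 if none)
findIdx : (ℕ → ℕ) → ℕ → List ℕ → ℕ
findIdx φ k []       = 0
findIdx φ k (i ∷ is) = if φ i ≡ᵇ k then i else findIdx φ k is

invφ : ℕ → (ℕ → ℕ) → ℕ → ℕ
invφ n φ k = findIdx φ k (range1 (half n))

-- weight of a directed edge of length φ(i), given the index i and ℓ
wIdx : (n : ℕ) .{{_ : NonZero n}} → (φ : ℕ → ℕ) → (ℓ : ℕ) → ℕ → ℚ
wIdx n φ ℓ i with <-cmp i ℓ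
... | tri< _ _ _ = (+ gseq n φ (i ∸ 1) ℤ.- + gseq n φ i) ℚ./ n
... | tri≈ _ _ _ = (+ gseq n φ (ℓ ∸ 1)) ℚ./ n
... | tri> _ _ _ = 0ℚ

xLen : (n : ℕ) .{{_ : NonZero n}} → (φ : ℕ → ℕ) → (ℓ : ℕ) → ℕ → ℚ
xLen n φ ℓ k = wIdx n φ ℓ (invφ n φ k)

shift : (n : ℕ) .{{_ : NonZero n}} → Fin n → ℕ → Fin n
shift n v k = (toℕ v ℕ.+ k) mod n

-- a directed edge: tail v and length k; it is (v, v + k mod n)
record DEdge (n : ℕ) : Set where
  constructor edge
  field
    tail   : Fin n
    length : ℕ

-- all directed edges: (v, v+k) for v ∈ V, k ∈ [d]
-- (for k = n/2 this list contains both (v, v+n/2) and (v+n/2, v), each once)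
edges : (n : ℕ) → List (DEdge n)
edges n = concatMap (λ v → map (edge v) (range1 (half n))) (allFin n)

crosses : (n : ℕ) .{{_ : NonZero n}} → Subset n → DEdge n → Bool
crosses n S (edge v k) = lookup S v xor lookup S (shift n v k)

sumℚ : List ℚ → ℚ
sumℚ = foldr ℚ._+_ 0ℚ

xδ : (n : ℕ) .{{_ : NonZero n}} → (φ : ℕ → ℕ) → (ℓ : ℕ) → Subset n → ℚ
xδ n φ ℓ S = sumℚ (map (λ e → if crosses n S e then xLen n φ ℓ (DEdge.length e) else 0ℚ) (edges n))

{-# OPTIONS --safe #-}

-- Read S as a Boolean sequence s on ℤ/nℤ and let c be its fundamental period; then c ∣ n, and
-- c ≥ 2 because S is neither empty nor everything. For a length k with c ∤ k the sequence s is not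
-- k-periodic, so each period of s contains a vertex leaving S and one entering S along length-k
-- edges: at least 2n/c edges of length k cross S. It therefore suffices that the lengths not
-- divisible by c carry total weight n·x ≥ c. Along g₀ = n, g₁, …, g_ℓ = 1 the number gcd(c, gᵢ)
-- falls from c to 1; it stays put when c ∣ φ(i), and otherwise it drops by at most gᵢ₋₁ − gᵢ,
-- since gcd(c, gᵢ₋₁) + gᵢ ≤ lcm + gcd ≤ gᵢ₋₁ + gcd(c, gᵢ).

module Submission where

open import Defs
open import Data.Nat using (ℕ; suc; _≤_; _<_; _∸_; NonZero)
open import Data.Rational using (ℚ; 1ℚ) renaming (_≤_ to _≤ℚ_; _+_ to _+ℚ_)
open import Data.Fin.Subset using (Subset; ∣_∣)
open import Relation.Binary.PropositionalEquality using (_≡_; _≢_)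
open import Data.Product using (_×_)

open import Data.Bool using (Bool; true; false; not; _xor_; if_then_else_)
import Data.Bool.Properties as Bool
open import Data.Fin as Fin using (Fin; toℕ; fromℕ<)
open import Data.Fin.Properties using (all?; ¬∀⟶∃¬; toℕ-injective; toℕ-fromℕ<; toℕ<n)
open import Data.Integer as ℤ using ()
import Data.Integer.Properties as ℤ
open import Data.Integer.Solver using () renaming (module +-*-Solver to ℤ-Solver)
open import Data.List as List using (List; []; _∷_; map; applyUpTo; upTo; tabulate; concatMap)
open import Data.List.Properties using (map-cong; map-∘; map-++; map-tabulate)
open import Data.List.Membership.Propositional using (_∈_)
open import Data.List.Membership.Propositional.Properties using (∈-map⁺; ∈-map⁻; ∈-upTo⁺; ∈-upTo⁻)
open import Data.List.Relation.Unary.Any using (here; there)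
open import Data.Nat
open import Data.Nat.Properties
open import Algebra.Properties.CommutativeSemigroup +-commutativeSemigroup using (interchange)
open import Data.Nat.Divisibility
open import Data.Nat.DivMod
open import Data.Nat.GCD
open import Data.Nat.LCM
open import Data.Nat.ListAction using (sum)
open import Data.Nat.ListAction.Properties using (sum-++)
open import Data.Nat.Solver using (module +-*-Solver)
open import Data.Product using (∃-syntax; _,_; proj₁; proj₂)
open import Data.Rational as ℚ using (0ℚ; toℚᵘ)
import Data.Rational.Properties as ℚ
open import Data.Rational.Unnormalised as ℚᵘ using (mkℚᵘ; *≡*; *≤*)
import Data.Rational.Unnormalised.Properties as ℚᵘ
open import Data.Sum using (_⊎_; inj₁; inj₂; [_,_]′)
open import Data.Vec using (_∷_; lookup)
open import Function using (_∘_; id)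
open import Relation.Binary.PropositionalEquality hiding ([_])
open import Relation.Binary.Definitions using (DecidableEquality; tri<; tri≈; tri>)
open import Relation.Nullary using (¬_; Dec; yes; no; map′; proof; ofʸ; ofⁿ; contradiction)
open import Relation.Unary using (Decidable)

-- Finite sums

[_≡_]·_ : ℕ → ℕ → ℕ → ℕ
[ x ≡ k ]· a = if x ≡ᵇ k then a else 0

∑ : ℕ → (ℕ → ℕ) → ℕ
∑ zero    f = 0
∑ (suc m) f = f 0 + ∑ m (f ∘ suc)

∑-cong : ∀ m {f g} → (∀ {i} → i < m → f i ≡ g i) → ∑ m f ≡ ∑ m g
∑-cong zero    f≡g = refl
∑-cong (suc m) f≡g = cong₂ _+_ (f≡g z<s) (∑-cong m (f≡g ∘ s<s))

∑-mono-≤ : ∀ m {f g} → (∀ {i} → i < m → f i ≤ g i) → ∑ m f ≤ ∑ m g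
∑-mono-≤ zero    f≤g = z≤n
∑-mono-≤ (suc m) f≤g = +-mono-≤ (f≤g z<s) (∑-mono-≤ m (f≤g ∘ s<s))

∑-mono-< : ∀ m {f g} → (∀ {i} → i < m → f i ≤ g i) → ∀ {k} → k < m → f k < g k → ∑ m f < ∑ m g
∑-mono-< (suc m) f≤g {zero}  _         fk<gk = +-mono-<-≤ fk<gk (∑-mono-≤ m (f≤g ∘ s<s))
∑-mono-< (suc m) f≤g {suc k} (s<s k<m) fk<gk = +-mono-≤-< (f≤g z<s) (∑-mono-< m (f≤g ∘ s<s) k<m fk<gk)

∑-zero : ∀ m {f} → (∀ {i} → i < m → f i ≡ 0) → ∑ m f ≡ 0
∑-zero zero    f≡0 = refl
∑-zero (suc m) f≡0 = cong₂ _+_ (f≡0 z<s) (∑-zero m (f≡0 ∘ s<s))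

∑-const : ∀ m a → ∑ m (λ _ → a) ≡ m * a
∑-const zero    a = refl
∑-const (suc m) a = cong (a +_) (∑-const m a)

∑-distrib-+ : ∀ m (f g : ℕ → ℕ) → ∑ m (λ i → f i + g i) ≡ ∑ m f + ∑ m g
∑-distrib-+ zero    f g = refl
∑-distrib-+ (suc m) f g = begin
  f 0 + g 0 + ∑ m (λ i → f (suc i) + g (suc i))    ≡⟨ cong (f 0 + g 0 +_) (∑-distrib-+ m (f ∘ suc) (g ∘ suc)) ⟩
  f 0 + g 0 + (∑ m (f ∘ suc) + ∑ m (g ∘ suc))      ≡⟨ interchange (f 0) (g 0) _ _ ⟩
  f 0 + ∑ m (f ∘ suc) + (g 0 + ∑ m (g ∘ suc))      ∎
  where open ≡-Reasoning

∑-distribˡ-* : ∀ m a (f : ℕ → ℕ) → ∑ m (λ i → a * f i) ≡ a * ∑ m f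
∑-distribˡ-* zero    a f = sym (*-zeroʳ a)
∑-distribˡ-* (suc m) a f = trans (cong (a * f 0 +_) (∑-distribˡ-* m a (f ∘ suc))) (sym (*-distribˡ-+ a (f 0) _))

∑-swap : ∀ m p (h : ℕ → ℕ → ℕ) → ∑ m (λ i → ∑ p (h i)) ≡ ∑ p (λ k → ∑ m (λ i → h i k))
∑-swap zero    p h = sym (∑-zero p (λ _ → refl))
∑-swap (suc m) p h = trans (cong (∑ p (h 0) +_) (∑-swap m p (h ∘ suc)))
                           (sym (∑-distrib-+ p (h 0) (λ k → ∑ m (λ i → h (suc i) k))))

∑-split : ∀ p q (f : ℕ → ℕ) → ∑ (p + q) f ≡ ∑ p f + ∑ q (λ i → f (p + i))
∑-split zero    q f = refl
∑-split (suc p) q f = trans (cong (f 0 +_) (∑-split p q (f ∘ suc))) (sym (+-assoc (f 0) _ _))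

∑-snoc : ∀ m (f : ℕ → ℕ) → ∑ (suc m) f ≡ ∑ m f + f m
∑-snoc zero    f = +-identityʳ (f 0)
∑-snoc (suc m) f = trans (cong (f 0 +_) (∑-snoc m (f ∘ suc))) (sym (+-assoc (f 0) _ _))

∑-prefix-≤ : ∀ {p q} (f : ℕ → ℕ) → p ≤ q → ∑ p f ≤ ∑ q f
∑-prefix-≤ {p} {q} f p≤q = begin
  ∑ p f                                 ≤⟨ m≤m+n (∑ p f) _ ⟩
  ∑ p f + ∑ (q ∸ p) (λ i → f (p + i))   ≡⟨ ∑-split p (q ∸ p) f ⟨
  ∑ (p + (q ∸ p)) f                     ≡⟨ cong (λ k → ∑ k f) (m+[n∸m]≡n p≤q) ⟩
  ∑ q f                                 ∎
  where open ≤-Reasoning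

∑-periodic : ∀ a c (f : ℕ → ℕ) → (∀ x → f (x + c) ≡ f x) → ∑ (a * c) f ≡ a * ∑ c f
∑-periodic zero    c f f-per = refl
∑-periodic (suc a) c f f-per = begin
  ∑ (c + a * c) f                          ≡⟨ ∑-split c (a * c) f ⟩
  ∑ c f + ∑ (a * c) (λ i → f (c + i))      ≡⟨ cong (∑ c f +_) (∑-cong (a * c) (λ {i} _ → trans (cong f (+-comm c i)) (f-per i))) ⟩
  ∑ c f + ∑ (a * c) f                      ≡⟨ cong (∑ c f +_) (∑-periodic a c f f-per) ⟩
  ∑ c f + a * ∑ c f                        ∎
  where open ≡-Reasoning

∑-single : ∀ m x (f : ℕ → ℕ) → x < m → ∑ m (λ k → [ x ≡ k ]· f k) ≡ f x
∑-single (suc m) zero    f _         = trans (cong (f 0 +_) (∑-zero m (λ _ → refl))) (+-identityʳ (f 0))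
∑-single (suc m) (suc x) f (s<s x<m) = ∑-single m x (f ∘ suc) x<m

∑≢0⇒∃ : ∀ m (f : ℕ → ℕ) → ∑ m f ≢ 0 → ∃[ j ] j < m × f j ≢ 0
∑≢0⇒∃ zero    f ∑≢0 = contradiction refl ∑≢0
∑≢0⇒∃ (suc m) f ∑≢0 with f 0 ≟ 0
... | no  f0≢0 = 0 , z<s , f0≢0
... | yes f0≡0 with ∑≢0⇒∃ m (f ∘ suc) (λ ∑≡0 → ∑≢0 (cong₂ _+_ f0≡0 ∑≡0))
...   | j , j<m , fj≢0 = suc j , s<s j<m , fj≢0

∑-≥-pair : ∀ m (f : ℕ → ℕ) {x y} → x < m → y < m → x ≢ y → f x + f y ≤ ∑ m f
∑-≥-pair m f {x} {y} x<m y<m x≢y = begin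
  f x + f y                                      ≡⟨ cong₂ _+_ (∑-single m x f x<m) (∑-single m y f y<m) ⟨
  ∑ m (δ x) + ∑ m (δ y)                          ≡⟨ ∑-distrib-+ m (δ x) (δ y) ⟨
  ∑ m (λ k → δ x k + δ y k)                      ≤⟨ ∑-mono-≤ m (λ {k} _ → δx+δy≤f k) ⟩
  ∑ m f                                          ∎
  where
  open ≤-Reasoning
  δ : ℕ → ℕ → ℕ
  δ z k = [ z ≡ k ]· f k
  δx+δy≤f : ∀ k → δ x k + δ y k ≤ f k
  δx+δy≤f k with x ≡ᵇ k | proof (x ≟ k) | y ≡ᵇ k | proof (y ≟ k)
  ... | true  | ofʸ refl | true  | ofʸ refl = contradiction refl x≢y
  ... | true  | _        | false | _        = ≤-reflexive (+-identityʳ (f k))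
  ... | false | _        | true  | _        = ≤-refl
  ... | false | _        | false | _        = z≤n

InjectiveOn : ℕ → (ℕ → ℕ) → Set
InjectiveOn m ψ = ∀ {i j} → i < m → j < m → ψ i ≡ ψ j → i ≡ j

MapsInto : ℕ → (ℕ → ℕ) → Set
MapsInto m ψ = ∀ {j} → j < m → ψ j < m

∑-fiber-≤ : ∀ m (ψ : ℕ → ℕ) k a → InjectiveOn m ψ → ∑ m (λ j → [ ψ j ≡ k ]· a) ≤ a
∑-fiber-≤ zero    ψ k a ψ-inj = z≤n
∑-fiber-≤ (suc m) ψ k a ψ-inj with ψ 0 ≡ᵇ k | proof (ψ 0 ≟ k)
... | false | _          = ∑-fiber-≤ m (ψ ∘ suc) k a (λ i<m j<m eq → suc-injective (ψ-inj (s<s i<m) (s<s j<m) eq))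
... | true  | ofʸ ψ0≡k = ≤-reflexive (trans (cong (a +_) (∑-zero m rest≡0)) (+-identityʳ a))
  where
  rest≡0 : ∀ {i} → i < m → [ ψ (suc i) ≡ k ]· a ≡ 0
  rest≡0 {i} i<m with ψ (suc i) ≡ᵇ k | proof (ψ (suc i) ≟ k)
  ... | false | _           = refl
  ... | true  | ofʸ ψsi≡k with () ← ψ-inj (s<s i<m) z<s (trans ψsi≡k (sym ψ0≡k))

∑-reindex-≤ : ∀ d (ψ f : ℕ → ℕ) → MapsInto d ψ → InjectiveOn d ψ → ∑ d (f ∘ ψ) ≤ ∑ d f
∑-reindex-≤ d ψ f ψ-into ψ-inj = begin
  ∑ d (f ∘ ψ)                                 ≡⟨ ∑-cong d (λ j<d → sym (∑-single d (ψ _) f (ψ-into j<d))) ⟩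
  ∑ d (λ j → ∑ d (λ k → [ ψ j ≡ k ]· f k))    ≡⟨ ∑-swap d d _ ⟩
  ∑ d (λ k → ∑ d (λ j → [ ψ j ≡ k ]· f k))    ≤⟨ ∑-mono-≤ d (λ {k} _ → ∑-fiber-≤ d ψ k (f k) ψ-inj) ⟩
  ∑ d f                                       ∎
  where open ≤-Reasoning

injective⇒surjective : ∀ d (ψ : ℕ → ℕ) → MapsInto d ψ → InjectiveOn d ψ → ∀ {k} → k < d → ∃[ j ] j < d × ψ j ≡ k
injective⇒surjective d ψ ψ-into ψ-inj {k} k<d with ∑≢0⇒∃ d (λ j → [ ψ j ≡ k ]· 1) fiber≢0
  where
  fiber : ℕ → ℕ
  fiber k = ∑ d (λ j → [ ψ j ≡ k ]· 1)
  ∑fiber≡d : ∑ d fiber ≡ d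
  ∑fiber≡d = begin
    ∑ d fiber                ≡⟨ ∑-swap d d (λ j k → [ ψ j ≡ k ]· 1) ⟨
    ∑ d (λ j → ∑ d _)        ≡⟨ ∑-cong d (λ j<d → ∑-single d (ψ _) (λ _ → 1) (ψ-into j<d)) ⟩
    ∑ d (λ _ → 1)            ≡⟨ ∑-const d 1 ⟩
    d * 1                    ≡⟨ *-identityʳ d ⟩
    d                        ∎
    where open ≡-Reasoning
  fiber≢0 : fiber k ≢ 0
  fiber≢0 fiber≡0 = <-irrefl ∑fiber≡d (begin-strict
    ∑ d fiber      <⟨ ∑-mono-< d (λ {i} _ → ∑-fiber-≤ d ψ i 1 ψ-inj) k<d (subst (_< 1) (sym fiber≡0) z<s) ⟩
    ∑ d (λ _ → 1)  ≡⟨ trans (∑-const d 1) (*-identityʳ d) ⟩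
    d              ∎)
    where open ≤-Reasoning
... | j , j<d , ψj≢k with ψ j ≡ᵇ k | proof (ψ j ≟ k)
...   | true  | ofʸ ψj≡k = j , j<d , ψj≡k
...   | false | _        = contradiction refl ψj≢k

-- The gcd chain

m+n≤lcm+gcd : ∀ m n → m + n ≤ lcm m n + gcd m n
m+n≤lcm+gcd zero n = ≤-reflexive (sym (gcd-identityˡ n))
m+n≤lcm+gcd m@(suc _) zero = ≤-reflexive (trans (+-identityʳ m) (sym (cong₂ _+_ (lcm[n,0]≡0 m) (gcd-identityʳ m))))
m+n≤lcm+gcd m@(suc _) n@(suc _) = *-cancelˡ-≤ h {{h≢0}} (begin
  h * (m + n)                 ≤⟨ m≤m+n (h * (m + n)) (a * b) ⟩
  h * (m + n) + a * b         ≡⟨ identity ⟨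
  h * (lcm m n + h)           ∎)
  where
  open ≤-Reasoning
  open +-*-Solver
  h = gcd m n
  a = m ∸ h
  b = n ∸ h
  h≢0 : NonZero h
  h≢0 = ≢-nonZero (gcd[m,n]≢0 m n (inj₂ λ ()))
  m≡h+a : m ≡ h + a
  m≡h+a = sym (m+[n∸m]≡n (∣⇒≤ (gcd[m,n]∣m m n)))
  n≡h+b : n ≡ h + b
  n≡h+b = sym (m+[n∸m]≡n (∣⇒≤ (gcd[m,n]∣n m n)))
  identity : h * (lcm m n + h) ≡ h * (m + n) + a * b
  identity = begin-equality
    h * (lcm m n + h)                 ≡⟨ *-distribˡ-+ h (lcm m n) h ⟩
    h * lcm m n + h * h               ≡⟨ cong (_+ h * h) (gcd*lcm m n) ⟩
    m * n + h * h                     ≡⟨ cong₂ (λ x y → x * y + h * h) m≡h+a n≡h+b ⟩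
    (h + a) * (h + b) + h * h         ≡⟨ solve 3 (λ h a b → (h :+ a) :* (h :+ b) :+ h :* h := h :* ((h :+ a) :+ (h :+ b)) :+ a :* b) refl h a b ⟩
    h * ((h + a) + (h + b)) + a * b   ≡⟨ cong₂ (λ x y → h * (x + y) + a * b) m≡h+a n≡h+b ⟨
    h * (m + n) + a * b               ∎

m+n≤lcm : ∀ {m n} → 2 ≤ m → 2 ≤ n → gcd m n ≡ 1 → m + n ≤ lcm m n
m+n≤lcm {m} {n} 2≤m 2≤n gcd≡1 = begin
  m + n                                  ≡⟨ cong₂ _+_ m≡2+a n≡2+b ⟩
  (2 + a) + (2 + b)                      ≤⟨ ≤-reflexive (solve 2 (λ a b → (con 2 :+ a) :+ (con 2 :+ b) := con 4 :+ a :+ b) refl a b) ⟩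
  4 + a + b                              ≤⟨ m≤m+n (4 + a + b) (a + b + a * b) ⟩
  4 + a + b + (a + b + a * b)            ≡⟨ solve 2 (λ a b → con 4 :+ a :+ b :+ (a :+ b :+ a :* b) := (con 2 :+ a) :* (con 2 :+ b)) refl a b ⟩
  (2 + a) * (2 + b)                      ≡⟨ cong₂ _*_ m≡2+a n≡2+b ⟨
  m * n                                  ≡⟨ gcd*lcm m n ⟨
  gcd m n * lcm m n                      ≡⟨ cong (_* lcm m n) gcd≡1 ⟩
  1 * lcm m n                            ≡⟨ *-identityˡ (lcm m n) ⟩
  lcm m n                                ∎
  where
  open ≤-Reasoning
  open +-*-Solver
  a = m ∸ 2
  b = n ∸ 2
  m≡2+a : m ≡ 2 + a
  m≡2+a = sym (m+[n∸m]≡n 2≤m)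
  n≡2+b : n ≡ 2 + b
  n≡2+b = sym (m+[n∸m]≡n 2≤n)

gcd[gcd[a,n],gcd[b,n]]≡gcd[a,gcd[b,n]] : ∀ a b n → gcd (gcd a n) (gcd b n) ≡ gcd a (gcd b n)
gcd[gcd[a,n],gcd[b,n]]≡gcd[a,gcd[b,n]] a b n = ∣-antisym
  (gcd-greatest (∣-trans (gcd[m,n]∣m (gcd a n) (gcd b n)) (gcd[m,n]∣m a n)) (gcd[m,n]∣n (gcd a n) (gcd b n)))
  (gcd-greatest (gcd-greatest (gcd[m,n]∣m a (gcd b n)) (∣-trans (gcd[m,n]∣n a (gcd b n)) (gcd[m,n]∣n b n)))
                (gcd[m,n]∣n a (gcd b n)))

a∣b⇒gcd[a,gcd[b,n]]≡gcd[a,n] : ∀ {a b} n → a ∣ b → gcd a (gcd b n) ≡ gcd a n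
a∣b⇒gcd[a,gcd[b,n]]≡gcd[a,n] {a} {b} n a∣b = ∣-antisym
  (gcd-greatest (gcd[m,n]∣m a (gcd b n)) (∣-trans (gcd[m,n]∣n a (gcd b n)) (gcd[m,n]∣n b n)))
  (gcd-greatest (gcd[m,n]∣m a n) (gcd-greatest (∣-trans (gcd[m,n]∣m a n) a∣b) (gcd[m,n]∣n a n)))

[_∤_] : ℕ → ℕ → ℕ
[ c ∤ k ] with c ∣? k
... | yes _ = 0
... | no  _ = 1

[∤]≡0 : ∀ {c k} → c ∣ k → [ c ∤ k ] ≡ 0
[∤]≡0 {c} {k} c∣k with c ∣? k
... | yes _   = refl
... | no  c∤k = contradiction c∣k c∤k

[∤]≡1 : ∀ {c k} → ¬ c ∣ k → [ c ∤ k ] ≡ 1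
[∤]≡1 {c} {k} c∤k with c ∣? k
... | yes c∣k = contradiction c∣k c∤k
... | no  _   = refl

module _ {n} (φ : ℕ → ℕ) (0<n : 0 < n) where

  gseq-pos : ∀ i → 0 < gseq n φ i
  gseq-pos zero    = 0<n
  gseq-pos (suc i) = n≢0⇒n>0 (gcd[m,n]≢0 (φ (suc i)) (gseq n φ i) (inj₂ (>⇒≢ (gseq-pos i))))

  gseq-antitone : ∀ i → gseq n φ (suc i) ≤ gseq n φ i
  gseq-antitone i = ∣⇒≤ {{>-nonZero (gseq-pos i)}} (gcd[m,n]∣n (φ (suc i)) (gseq n φ i))

-- n times the weight x of an edge of length φ i.
weight : ℕ → (ℕ → ℕ) → ℕ → ℕ → ℕ
weight n φ ℓ i with <-cmp i ℓ
... | tri< _ _ _ = gseq n φ (i ∸ 1) ∸ gseq n φ i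
... | tri≈ _ _ _ = gseq n φ (ℓ ∸ 1)
... | tri> _ _ _ = 0

weight-< : ∀ n φ {ℓ i} → i < ℓ → weight n φ ℓ i ≡ gseq n φ (i ∸ 1) ∸ gseq n φ i
weight-< n φ {ℓ} {i} i<ℓ with <-cmp i ℓ
... | tri< _ _ _  = refl
... | tri≈ i≮ℓ _ _ = contradiction i<ℓ i≮ℓ
... | tri> i≮ℓ _ _ = contradiction i<ℓ i≮ℓ

weight-≡ : ∀ n φ ℓ → weight n φ ℓ ℓ ≡ gseq n φ (ℓ ∸ 1)
weight-≡ n φ ℓ with <-cmp ℓ ℓ
... | tri< ℓ<ℓ _ _ = contradiction ℓ<ℓ (<-irrefl refl)
... | tri≈ _ _ _   = refl
... | tri> _ _ ℓ<ℓ = contradiction ℓ<ℓ (<-irrefl refl)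

module _ {n} (φ : ℕ → ℕ) (0<n : 0 < n) {c} (2≤c : 2 ≤ c) (c∣n : c ∣ n) where

  private
    g : ℕ → ℕ
    g = gseq n φ

    common : ℕ → ℕ
    common m = gcd c (g m)

    drop : ℕ → ℕ
    drop j = (g j ∸ g (suc j)) * [ c ∤ φ (suc j) ]

    -- The second clause pays for the final step when c ∣ φ ℓ: once gcd(c, g m) has reached 1
    -- while g m ≠ 1, the drops collected so far already add up to c.
    ChainInvariant : ℕ → Set
    ChainInvariant m = c ≤ ∑ m drop + common m × (common m ≡ 1 → 2 ≤ g m → c ≤ ∑ m drop)

    common-pos : ∀ m → 0 < common m
    common-pos m = n≢0⇒n>0 (gcd[m,n]≢0 c (g m) (inj₂ (>⇒≢ (gseq-pos φ 0<n m))))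

    common-step : ∀ m → gcd (common m) (g (suc m)) ≡ common (suc m)
    common-step m = gcd[gcd[a,n],gcd[b,n]]≡gcd[a,gcd[b,n]] c (φ (suc m)) (g m)

    lcm≤g : ∀ m → lcm (common m) (g (suc m)) ≤ g m
    lcm≤g m = ∣⇒≤ {{>-nonZero (gseq-pos φ 0<n m)}}
      (lcm-least (gcd[m,n]∣n c (g m)) (gcd[m,n]∣n (φ (suc m)) (g m)))

    common-drop : ∀ m → common m ≤ g m ∸ g (suc m) + common (suc m)
    common-drop m = begin
      common m                                 ≤⟨ m+n≤o⇒m≤o∸n (common m) (begin
        common m + g (suc m)                           ≤⟨ m+n≤lcm+gcd (common m) (g (suc m)) ⟩
        lcm (common m) (g (suc m)) + gcd (common m) (g (suc m)) ≤⟨ +-mono-≤ (lcm≤g m) (≤-reflexive (common-step m)) ⟩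
        g m + common (suc m)                           ∎) ⟩
      g m + common (suc m) ∸ g (suc m)         ≡⟨ +-∸-comm (common (suc m)) (gseq-antitone φ 0<n m) ⟩
      g m ∸ g (suc m) + common (suc m)         ∎
      where open ≤-Reasoning

    common-drop-to-1 : ∀ m → 2 ≤ common m → 2 ≤ g (suc m) → common (suc m) ≡ 1 → common m ≤ g m ∸ g (suc m)
    common-drop-to-1 m 2≤common 2≤g coprime = m+n≤o⇒m≤o∸n (common m) (≤-trans
      (m+n≤lcm 2≤common 2≤g (trans (common-step m) coprime)) (lcm≤g m))

    invariant-base : ChainInvariant 0
    invariant-base = ≤-reflexive (sym common[0]≡c) , λ c≡1 _ → contradiction (trans (sym common[0]≡c) c≡1) (>⇒≢ 2≤c)
      where
      common[0]≡c : common 0 ≡ c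
      common[0]≡c = ∣-antisym (gcd[m,n]∣m c n) (gcd-greatest ∣-refl c∣n)

    step-∣ : ∀ m → c ∣ φ (suc m) → ChainInvariant m → ChainInvariant (suc m)
    step-∣ m c∣φ (c≤∑+common , c≤∑) =
      subst₂ (λ s e → c ≤ s + e) (sym ∑-same) (sym common-same) c≤∑+common ,
      λ common≡1 2≤g → subst (c ≤_) (sym ∑-same)
        (c≤∑ (trans (sym common-same) common≡1) (≤-trans 2≤g (gseq-antitone φ 0<n m)))
      where
      common-same : common (suc m) ≡ common m
      common-same = a∣b⇒gcd[a,gcd[b,n]]≡gcd[a,n] (g m) c∣φ
      ∑-same : ∑ (suc m) drop ≡ ∑ m drop
      ∑-same = begin-equality
        ∑ (suc m) drop                                    ≡⟨ ∑-snoc m drop ⟩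
        ∑ m drop + (g m ∸ g (suc m)) * [ c ∤ φ (suc m) ]  ≡⟨ cong (λ x → ∑ m drop + (g m ∸ g (suc m)) * x) ([∤]≡0 c∣φ) ⟩
        ∑ m drop + (g m ∸ g (suc m)) * 0                  ≡⟨ cong (∑ m drop +_) (*-zeroʳ (g m ∸ g (suc m))) ⟩
        ∑ m drop + 0                                      ≡⟨ +-identityʳ (∑ m drop) ⟩
        ∑ m drop                                          ∎
        where open ≤-Reasoning

    step-∤ : ∀ m → ¬ c ∣ φ (suc m) → ChainInvariant m → ChainInvariant (suc m)
    step-∤ m c∤φ (c≤∑+common , c≤∑) = c≤∑′+common′ , c≤∑′
      where
      open ≤-Reasoning
      ∑-grows : ∑ (suc m) drop ≡ ∑ m drop + (g m ∸ g (suc m))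
      ∑-grows = trans (∑-snoc m drop)
        (cong (∑ m drop +_) (trans (cong ((g m ∸ g (suc m)) *_) ([∤]≡1 c∤φ)) (*-identityʳ _)))
      c≤∑′+common′ : c ≤ ∑ (suc m) drop + common (suc m)
      c≤∑′+common′ = begin
        c                                                  ≤⟨ c≤∑+common ⟩
        ∑ m drop + common m                                ≤⟨ +-monoʳ-≤ (∑ m drop) (common-drop m) ⟩
        ∑ m drop + (g m ∸ g (suc m) + common (suc m))      ≡⟨ +-assoc (∑ m drop) _ _ ⟨
        ∑ m drop + (g m ∸ g (suc m)) + common (suc m)      ≡⟨ cong (_+ common (suc m)) ∑-grows ⟨
        ∑ (suc m) drop + common (suc m)                    ∎
      c≤∑′ : common (suc m) ≡ 1 → 2 ≤ g (suc m) → c ≤ ∑ (suc m) drop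
      c≤∑′ common′≡1 2≤g′ with common m ≟ 1
      ... | yes common≡1 = ≤-trans (c≤∑ common≡1 (≤-trans 2≤g′ (gseq-antitone φ 0<n m)))
                                   (≤-trans (m≤m+n _ _) (≤-reflexive (sym ∑-grows)))
      ... | no  common≢1 = begin
        c                                   ≤⟨ c≤∑+common ⟩
        ∑ m drop + common m                 ≤⟨ +-monoʳ-≤ (∑ m drop) (common-drop-to-1 m 2≤common 2≤g′ common′≡1) ⟩
        ∑ m drop + (g m ∸ g (suc m))        ≡⟨ ∑-grows ⟨
        ∑ (suc m) drop                      ∎
        where
        2≤common : 2 ≤ common m
        2≤common = ≤∧≢⇒< (common-pos m) (common≢1 ∘ sym)

    invariant : ∀ m → ChainInvariant m
    invariant zero = invariant-base
    invariant (suc m) with c ∣? φ (suc m)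
    ... | yes c∣φ = step-∣ m c∣φ (invariant m)
    ... | no  c∤φ = step-∤ m c∤φ (invariant m)

  chain-bound : ∀ L → gseq n φ (suc L) ≡ 1 → gseq n φ L ≢ 1 →
                c ≤ ∑ (suc L) (λ j → weight n φ (suc L) (suc j) * [ c ∤ φ (suc j) ])
  chain-bound L g[ℓ]≡1 g[L]≢1 = subst (c ≤_) (sym ∑≡) (last-step (c ∣? φ (suc L)) (invariant L))
    where
    w : ℕ → ℕ
    w j = weight n φ (suc L) (suc j) * [ c ∤ φ (suc j) ]
    ∑≡ : ∑ (suc L) w ≡ ∑ L drop + g L * [ c ∤ φ (suc L) ]
    ∑≡ = trans (∑-snoc L w) (cong₂ _+_
      (∑-cong L (λ j<L → cong (_* [ c ∤ φ _ ]) (weight-< n φ (s<s j<L))))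
      (cong (_* [ c ∤ φ (suc L) ]) (weight-≡ n φ (suc L))))
    last-step : Dec (c ∣ φ (suc L)) → ChainInvariant L → c ≤ ∑ L drop + g L * [ c ∤ φ (suc L) ]
    last-step (no c∤φ) (c≤∑+common , _) = begin
      c                                   ≤⟨ c≤∑+common ⟩
      ∑ L drop + common L                 ≤⟨ +-monoʳ-≤ (∑ L drop) (∣⇒≤ {{>-nonZero (gseq-pos φ 0<n L)}} (gcd[m,n]∣n c (g L))) ⟩
      ∑ L drop + g L                      ≡⟨ cong (∑ L drop +_) (trans (sym (*-identityʳ (g L))) (cong (g L *_) (sym ([∤]≡1 c∤φ)))) ⟩
      ∑ L drop + g L * [ c ∤ φ (suc L) ]  ∎
      where open ≤-Reasoning
    last-step (yes c∣φ) (_ , c≤∑) = ≤-trans (c≤∑ common≡1 2≤g) (m≤m+n _ _)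
      where
      common≡1 : common L ≡ 1
      common≡1 = ∣1⇒≡1 (subst (common L ∣_) g[ℓ]≡1
        (gcd-greatest (∣-trans (gcd[m,n]∣m c (g L)) c∣φ) (gcd[m,n]∣n c (g L))))
      2≤g : 2 ≤ g L
      2≤g = ≤∧≢⇒< (gseq-pos φ 0<n L) (g[L]≢1 ∘ sym)

-- Periodic sequences

IsPeriod : {A : Set} → (ℕ → A) → ℕ → Set
IsPeriod f t = ∀ x → f (x + t) ≡ f x

module _ {A : Set} {f : ℕ → A} {t} (t-period : IsPeriod f t) where

  period-multiple : ∀ q x → f (x + q * t) ≡ f x
  period-multiple zero    x = cong f (+-identityʳ x)
  period-multiple (suc q) x = begin
    f (x + (t + q * t))   ≡⟨ cong f (trans (cong (x +_) (+-comm t (q * t))) (sym (+-assoc x (q * t) t))) ⟩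
    f (x + q * t + t)     ≡⟨ t-period (x + q * t) ⟩
    f (x + q * t)         ≡⟨ period-multiple q x ⟩
    f x                   ∎
    where open ≡-Reasoning

  module _ .{{_ : NonZero t}} where

    period-mod-shift : ∀ x u → f (x % t + u) ≡ f (x + u)
    period-mod-shift x u = begin
      f (x % t + u)                    ≡⟨ period-multiple (x / t) (x % t + u) ⟨
      f (x % t + u + x / t * t)        ≡⟨ cong f (+-assoc (x % t) u _) ⟩
      f (x % t + (u + x / t * t))      ≡⟨ cong (λ y → f (x % t + y)) (+-comm u _) ⟩
      f (x % t + (x / t * t + u))      ≡⟨ cong f (+-assoc (x % t) _ u) ⟨
      f (x % t + x / t * t + u)        ≡⟨ cong (λ y → f (y + u)) (m≡m%n+[m/n]*n x t) ⟨
      f (x + u)                        ∎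
      where open ≡-Reasoning

    period-mod : ∀ x → f (x % t) ≡ f x
    period-mod x = trans (cong f (sym (+-identityʳ (x % t)))) (trans (period-mod-shift x 0) (cong f (+-identityʳ x)))

    mod-period : ∀ {k} → IsPeriod f k → IsPeriod f (k % t)
    mod-period {k} k-period x = begin
      f (x + k % t)                   ≡⟨ period-multiple (k / t) (x + k % t) ⟨
      f (x + k % t + k / t * t)       ≡⟨ cong f (+-assoc x (k % t) _) ⟩
      f (x + (k % t + k / t * t))     ≡⟨ cong (λ y → f (x + y)) (m≡m%n+[m/n]*n k t) ⟨
      f (x + k)                       ≡⟨ k-period x ⟩
      f x                             ∎
      where open ≡-Reasoning

least-witness : {P : ℕ → Set} → Decidable P → ∀ {m} → P m → ∃[ c ] P c × (∀ {k} → k < c → ¬ P k)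
least-witness {P} P? {m} Pm with search (suc m)
  where
  search : ∀ m → (∃[ c ] P c × (∀ {k} → k < c → ¬ P k)) ⊎ (∀ {k} → k < m → ¬ P k)
  search zero = inj₂ λ ()
  search (suc m) with search m
  ... | inj₁ found = inj₁ found
  ... | inj₂ none with P? m
  ...   | yes Pm = inj₁ (m , Pm , none)
  ...   | no ¬Pm = inj₂ λ k<1+m → [ none , (λ { refl → ¬Pm }) ]′ (m≤n⇒m<n∨m≡n (s≤s⁻¹ k<1+m))
... | inj₁ found = found
... | inj₂ none  = contradiction Pm (none (n<1+n m))

module _ {A : Set} (_≟ᴬ_ : DecidableEquality A) {f : ℕ → A} {p} .{{_ : NonZero p}} (p-period : IsPeriod f p) where

  private
    test : ℕ → Fin p → Set
    test t x = f (toℕ x + t) ≡ f (toℕ x)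

  test⇒period : ∀ {t} → (∀ x → test t x) → IsPeriod f t
  test⇒period {t} passes x = begin
    f (x + t)                ≡⟨ period-mod-shift p-period x t ⟨
    f (x % p + t)            ≡⟨ cong (λ y → f (y + t)) (toℕ-fromℕ< x%p<p) ⟨
    f (toℕ x′ + t)           ≡⟨ passes x′ ⟩
    f (toℕ x′)               ≡⟨ cong f (toℕ-fromℕ< x%p<p) ⟩
    f (x % p)                ≡⟨ period-mod p-period x ⟩
    f x                      ∎
    where
    open ≡-Reasoning
    x%p<p = m%n<n x p
    x′ = fromℕ< x%p<p

  non-period-witness : ∀ {t} → ¬ IsPeriod f t → ∃[ x ] f (x + t) ≢ f x
  non-period-witness {t} ¬t-period with ¬∀⟶∃¬ p (test t) (λ x → f (toℕ x + t) ≟ᴬ f (toℕ x)) (¬t-period ∘ test⇒period)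
  ... | x , fails = toℕ x , fails

  fundamental-period : ∃[ c ] 0 < c × IsPeriod f c × (∀ {k} → IsPeriod f k → c ∣ k)
  fundamental-period with least-witness {IsPeriod f ∘ suc} isPeriod? (subst (IsPeriod f) (sym (suc-pred p)) p-period)
    where
    isPeriod? : ∀ t → Dec (IsPeriod f (suc t))
    isPeriod? t = map′ test⇒period (λ per x → per (toℕ x)) (all? (λ x → f (toℕ x + suc t) ≟ᴬ f (toℕ x)))
  ... | c-1 , c-period , smaller-not-period = suc c-1 , z<s , c-period , c∣period
    where
    c∣period : ∀ {k} → IsPeriod f k → suc c-1 ∣ k
    c∣period {k} k-period with k % suc c-1 in k%c≡r
    ... | zero  = m%n≡0⇒n∣m k (suc c-1) k%c≡r
    ... | suc r = contradiction (subst (IsPeriod f) k%c≡r (mod-period c-period k-period))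
                                (smaller-not-period (s≤s⁻¹ (subst (_< suc c-1) k%c≡r (m%n<n k (suc c-1)))))

switch-point : ∀ (b : ℕ → Bool) {β} N → b 0 ≡ β → b N ≡ not β → ∃[ t ] b t ≡ β × b (suc t) ≡ not β
switch-point b {β} zero    b0≡β b0≡¬β = contradiction b0≡¬β (Bool.not-¬ b0≡β)
switch-point b {β} (suc N) b0≡β bN≡¬β with b 1 Bool.≟ β
... | no  b1≢β = 0 , b0≡β , Bool.¬-not b1≢β
... | yes b1≡β with switch-point (b ∘ suc) N b1≡β bN≡¬β
...   | t , bt≡β , bt+1≡¬β = suc t , bt≡β , bt+1≡¬β

crossing : (ℕ → Bool) → ℕ → ℕ → ℕ
crossing s k v = if s v xor s (v + k) then 1 else 0

crossing≡1 : ∀ (s : ℕ → Bool) {k y β} → s y ≡ β → s (y + k) ≡ not β → crossing s k y ≡ 1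
crossing≡1 s {β = β} sy≡β sy+k≡¬β = trans (cong₂ (λ a b → if a xor b then 1 else 0) sy≡β sy+k≡¬β) (β-xor-¬β β)
  where
  β-xor-¬β : ∀ β → (if β xor not β then 1 else 0) ≡ 1
  β-xor-¬β false = refl
  β-xor-¬β true  = refl

module _ {s : ℕ → Bool} {c} .{{_ : NonZero c}} (c-period : IsPeriod s c) where

  -- Walking from y + k in steps of k returns to y + c k, where s takes the value β again.
  opposite-crossing : ∀ {k y β} → s y ≡ β → s (y + k) ≡ not β → ∃[ z ] s z ≡ not β × s (z + k) ≡ β
  opposite-crossing {k} {y} {β} sy≡β sy+k≡¬β
    with switch-point (λ t → s (y + k + t * k)) (c ∸ 1) start end
    where
    start : s (y + k + 0 * k) ≡ not β
    start = trans (cong s (+-identityʳ (y + k))) sy+k≡¬β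
    end : s (y + k + (c ∸ 1) * k) ≡ not (not β)
    end = begin
      s (y + k + (c ∸ 1) * k)   ≡⟨ cong s (+-assoc y k _) ⟩
      s (y + suc (c ∸ 1) * k)   ≡⟨ cong (λ m → s (y + m * k)) (suc-pred c) ⟩
      s (y + c * k)             ≡⟨ cong (λ m → s (y + m)) (*-comm c k) ⟩
      s (y + k * c)             ≡⟨ period-multiple c-period k y ⟩
      s y                       ≡⟨ trans sy≡β (sym (Bool.not-involutive β)) ⟩
      not (not β)               ∎
      where open ≡-Reasoning
  ... | t , s≡¬β , s≡¬¬β = y + k + t * k , s≡¬β , trans (cong s next) (trans s≡¬¬β (Bool.not-involutive β))
    where
    next : y + k + t * k + k ≡ y + k + (k + t * k)
    next = trans (+-assoc (y + k) (t * k) k) (cong (y + k +_) (+-comm (t * k) k))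

  crossing-periodic : ∀ k → IsPeriod (crossing s k) c
  crossing-periodic k v = cong₂ (λ a b → if a xor b then 1 else 0) (c-period v)
    (trans (cong s (trans (+-assoc v c k) (trans (cong (v +_) (+-comm c k)) (sym (+-assoc v k c))))) (c-period (v + k)))

  two-crossings : ∀ {k} → ¬ IsPeriod s k → 2 ≤ ∑ c (crossing s k)
  two-crossings {k} ¬k-period
    with x , s[x+k]≢s[x] ← non-period-witness Bool._≟_ c-period ¬k-period
    with z , s[z]≡¬s[x] , s[z+k]≡s[x] ← opposite-crossing {k} {x} refl (Bool.¬-not s[x+k]≢s[x])
    = begin
      2                                           ≡⟨ cong₂ _+_ cx≡1 cz≡1 ⟨
      f (x % c) + f (z % c)                       ≤⟨ ∑-≥-pair c f (m%n<n x c) (m%n<n z c) x%c≢z%c ⟩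
      ∑ c f                                       ∎
    where
    open ≤-Reasoning
    f = crossing s k
    cx≡1 : f (x % c) ≡ 1
    cx≡1 = trans (period-mod (crossing-periodic k) x) (crossing≡1 s refl (Bool.¬-not s[x+k]≢s[x]))
    cz≡1 : f (z % c) ≡ 1
    cz≡1 = trans (period-mod (crossing-periodic k) z)
                 (crossing≡1 s s[z]≡¬s[x] (trans s[z+k]≡s[x] (sym (Bool.not-involutive (s x)))))
    x%c≢z%c : x % c ≢ z % c
    x%c≢z%c eq = Bool.not-¬ refl
      (trans (sym (period-mod c-period x)) (trans (cong s eq) (trans (period-mod c-period z) s[z]≡¬s[x])))

  crossings-≥ : ∀ {n k} → c ∣ n → ¬ IsPeriod s k → 2 * n ≤ c * ∑ n (crossing s k)
  crossings-≥ {n} {k} (divides q refl) ¬k-period = begin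
    2 * (q * c)                       ≡⟨ solve ⟩
    c * (q * 2)                       ≤⟨ *-monoʳ-≤ c (*-monoʳ-≤ q (two-crossings ¬k-period)) ⟩
    c * (q * ∑ c (crossing s k))      ≡⟨ cong (c *_) (∑-periodic q c (crossing s k) (crossing-periodic k)) ⟨
    c * ∑ (q * c) (crossing s k)      ∎
    where
    open ≤-Reasoning
    solve : 2 * (q * c) ≡ c * (q * 2)
    solve = trans (*-comm 2 (q * c)) (trans (cong (_* 2) (*-comm q c)) (*-assoc c q 2))

nonconstant⇒2≤period : ∀ {A : Set} {f : ℕ → A} {c} x y → IsPeriod f c → 0 < c → f x ≢ f y → 2 ≤ c
nonconstant⇒2≤period {c = suc (suc _)} _ _ _ _ _ = s≤s (s≤s z≤n)
nonconstant⇒2≤period {f = f} {suc zero} x y 1-period _ fx≢fy = contradiction (trans (constant x) (sym (constant y))) fx≢fy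
  where
  constant : ∀ x → f x ≡ f 0
  constant zero    = refl
  constant (suc x) = trans (cong f (+-comm 1 x)) (trans (1-period x) (constant x))

-- x(δ(S)) as a sum over edge lengths

module _ (m : ℕ) where

  private
    toℚᵘ-/ : ∀ a → toℚᵘ (ℤ.+ a ℚ./ suc m) ℚᵘ.≃ mkℚᵘ (ℤ.+ a) m
    toℚᵘ-/ a = ℚ.toℚᵘ-fromℚᵘ (mkℚᵘ (ℤ.+ a) m)

  /-+ : ∀ a b → (ℤ.+ a ℚ./ suc m) ℚ.+ (ℤ.+ b ℚ./ suc m) ≡ ℤ.+ (a + b) ℚ./ suc m
  /-+ a b = ℚ.toℚᵘ-injective (ℚᵘ.≃-trans (ℚ.toℚᵘ-homo-+ (ℤ.+ a ℚ./ suc m) (ℤ.+ b ℚ./ suc m))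
    (ℚᵘ.≃-trans (ℚᵘ.+-cong (toℚᵘ-/ a) (toℚᵘ-/ b)) (ℚᵘ.≃-trans (*≡* cross-multiplied) (ℚᵘ.≃-sym (toℚᵘ-/ (a + b))))))
    where
    open ℤ-Solver
    cross-multiplied : (ℤ.+ a ℤ.* ℤ.+ suc m ℤ.+ ℤ.+ b ℤ.* ℤ.+ suc m) ℤ.* ℤ.+ suc m ≡ ℤ.+ (a + b) ℤ.* (ℤ.+ suc m ℤ.* ℤ.+ suc m)
    cross-multiplied rewrite ℤ.pos-+ a b =
      solve 3 (λ x y z → (x :* z :+ y :* z) :* z := (x :+ y) :* (z :* z)) refl (ℤ.+ a) (ℤ.+ b) (ℤ.+ suc m)

  sumℚ-map-/ : ∀ {X : Set} (a : X → ℕ) xs → sumℚ (map (λ x → ℤ.+ a x ℚ./ suc m) xs) ≡ ℤ.+ sum (map a xs) ℚ./ suc m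
  sumℚ-map-/ a []       = sym (ℚ.0/n≡0 (suc m))
  sumℚ-map-/ a (x ∷ xs) = trans (cong (ℤ.+ a x ℚ./ suc m ℚ.+_) (sumℚ-map-/ a xs)) (/-+ (a x) _)

  2≤/ : ∀ {a} → 2 * suc m ≤ a → (1ℚ +ℚ 1ℚ) ≤ℚ ℤ.+ a ℚ./ suc m
  2≤/ {a} 2n≤a = ℚ.toℚᵘ-cancel-≤ (ℚᵘ.≤-respˡ-≃ (ℚᵘ.≃-sym (ℚ.toℚᵘ-homo-+ 1ℚ 1ℚ))
    (ℚᵘ.≤-respʳ-≃ (ℚᵘ.≃-sym (toℚᵘ-/ a))
      (*≤* (ℤ.≤-trans (ℤ.+≤+ 2n≤a) (ℤ.≤-reflexive (trans (cong ℤ.+_ (sym (*-identityʳ a))) (ℤ.pos-* a 1)))))))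

sum-map-concatMap : ∀ {A B : Set} (a : B → ℕ) (F : A → List B) xs →
                    sum (map a (concatMap F xs)) ≡ sum (map (sum ∘ map a ∘ F) xs)
sum-map-concatMap a F []       = refl
sum-map-concatMap a F (x ∷ xs) = begin
  sum (map a (F x List.++ concatMap F xs))            ≡⟨ cong sum (map-++ a (F x) (concatMap F xs)) ⟩
  sum (map a (F x) List.++ map a (concatMap F xs))    ≡⟨ sum-++ (map a (F x)) _ ⟩
  sum (map a (F x)) + sum (map a (concatMap F xs))    ≡⟨ cong (sum (map a (F x)) +_) (sum-map-concatMap a F xs) ⟩
  sum (map a (F x)) + sum (map (sum ∘ map a ∘ F) xs)  ∎
  where open ≡-Reasoning

sum-tabulate : ∀ m (h : Fin m → ℕ) {f} → (∀ i → h i ≡ f (toℕ i)) → sum (tabulate h) ≡ ∑ m f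
sum-tabulate zero    h h≡f = refl
sum-tabulate (suc m) h h≡f = cong₂ _+_ (h≡f Fin.zero) (sum-tabulate m (h ∘ Fin.suc) (h≡f ∘ Fin.suc))

sum-map-applyUpTo : ∀ {A : Set} (a : A → ℕ) f m → sum (map a (applyUpTo f m)) ≡ ∑ m (a ∘ f)
sum-map-applyUpTo a f zero    = refl
sum-map-applyUpTo a f (suc m) = cong (a (f 0) +_) (sum-map-applyUpTo a (f ∘ suc) m)

findIdx-unique : ∀ (φ : ℕ → ℕ) {i} xs → i ∈ xs → (∀ {j} → j ∈ xs → φ j ≡ φ i → j ≡ i) → findIdx φ (φ i) xs ≡ i
findIdx-unique φ {i} (j ∷ xs) i∈ φ-inj with φ j ≡ᵇ φ i | proof (φ j ≟ φ i)
... | true  | ofʸ φj≡φi = φ-inj (here refl) φj≡φi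
... | false | ofⁿ φj≢φi with i∈
...   | here refl = contradiction refl φj≢φi
...   | there i∈xs = findIdx-unique φ xs i∈xs (φ-inj ∘ there)

member : (n : ℕ) .{{_ : NonZero n}} → Subset n → ℕ → Bool
member n S x = lookup S (x mod n)

mod-toℕ : ∀ {n} .{{_ : NonZero n}} (v : Fin n) → toℕ v mod n ≡ v
mod-toℕ v = toℕ-injective (trans (toℕ-fromℕ< _) (m<n⇒m%n≡m (toℕ<n v)))

module _ {n} .{{_ : NonZero n}} (S : Subset n) where

  member-toℕ : ∀ v → member n S (toℕ v) ≡ lookup S v
  member-toℕ v = cong (lookup S) (mod-toℕ v)

  member-periodic : IsPeriod (member n S) n
  member-periodic x = cong (lookup S) (toℕ-injective (trans (toℕ-fromℕ< _) (trans ([m+n]%n≡m%n x n) (sym (toℕ-fromℕ< _)))))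

lengthWeight : (n : ℕ) → (ℕ → ℕ) → ℕ → ℕ → ℕ
lengthWeight n φ ℓ k = weight n φ ℓ (invφ n φ k)

wIdx≡weight/n : ∀ m φ ℓ i → wIdx (suc m) φ ℓ i ≡ ℤ.+ weight (suc m) φ ℓ i ℚ./ suc m
wIdx≡weight/n m φ ℓ i with <-cmp i ℓ
... | tri< _ _ _ = cong (ℚ._/ suc m) (trans (ℤ.m-n≡m⊖n (gseq (suc m) φ (i ∸ 1)) (gseq (suc m) φ i)) (ℤ.⊖-≥ (antitone i)))
  where
  antitone : ∀ i → gseq (suc m) φ i ≤ gseq (suc m) φ (i ∸ 1)
  antitone zero    = ≤-refl
  antitone (suc i) = gseq-antitone φ z<s i
... | tri≈ _ _ _ = refl
... | tri> _ _ _ = sym (ℚ.0/n≡0 (suc m))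

module _ (m : ℕ) (φ : ℕ → ℕ) (ℓ : ℕ) (S : Subset (suc m)) where

  private
    n d : ℕ
    n = suc m
    d = half n
    s : ℕ → Bool
    s = member n S
    W : ℕ → ℕ
    W = lengthWeight n φ ℓ
    term : DEdge n → ℕ
    term (edge v k) = W k * crossing s k (toℕ v)

    edge-term : ∀ e → (if crosses n S e then xLen n φ ℓ (DEdge.length e) else 0ℚ) ≡ ℤ.+ term e ℚ./ n
    edge-term (edge v k) = trans (cong (λ b → if b xor s (toℕ v + k) then xLen n φ ℓ k else 0ℚ) (sym (member-toℕ S v)))
                                 (select (s (toℕ v) xor s (toℕ v + k)))
      where
      select : ∀ b → (if b then xLen n φ ℓ k else 0ℚ) ≡ ℤ.+ (W k * (if b then 1 else 0)) ℚ./ n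
      select true  = trans (wIdx≡weight/n m φ ℓ (invφ n φ k)) (cong (λ w → ℤ.+ w ℚ./ n) (sym (*-identityʳ (W k))))
      select false = trans (sym (ℚ.0/n≡0 n)) (cong (λ w → ℤ.+ w ℚ./ n) (sym (*-zeroʳ (W k))))

    sum-edges : sum (map term (edges n)) ≡ ∑ n (λ v → ∑ d (λ j → W (suc j) * crossing s (suc j) v))
    sum-edges = begin
      sum (map term (edges n))                                    ≡⟨ sum-map-concatMap term (λ v → map (edge v) (range1 d)) (List.allFin n) ⟩
      sum (map rowSum (tabulate id))                              ≡⟨ cong sum (map-tabulate id rowSum) ⟩
      sum (tabulate rowSum)                                       ≡⟨ sum-tabulate n rowSum {f = row′} row ⟩
      ∑ n (λ v → ∑ d (λ j → W (suc j) * crossing s (suc j) v))    ∎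
      where
      open ≡-Reasoning
      rowSum : Fin n → ℕ
      rowSum v = sum (map term (map (edge v) (range1 d)))
      row′ : ℕ → ℕ
      row′ v = ∑ d (λ j → W (suc j) * crossing s (suc j) v)
      row : ∀ v → rowSum v ≡ row′ (toℕ v)
      row v = begin
        sum (map term (map (edge v) (map suc (upTo d))))      ≡⟨ cong sum (map-∘ (map suc (upTo d))) ⟨
        sum (map (term ∘ edge v) (map suc (upTo d)))          ≡⟨ cong sum (map-∘ (upTo d)) ⟨
        sum (map (term ∘ edge v ∘ suc) (upTo d))              ≡⟨ sum-map-applyUpTo (term ∘ edge v ∘ suc) id d ⟩
        ∑ d (λ j → W (suc j) * crossing s (suc j) (toℕ v))    ∎

  xδ≡∑/n : xδ n φ ℓ S ≡ ℤ.+ ∑ d (λ j → W (suc j) * ∑ n (crossing s (suc j))) ℚ./ n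
  xδ≡∑/n = begin
    xδ n φ ℓ S                                                     ≡⟨ cong sumℚ (map-cong edge-term (edges n)) ⟩
    sumℚ (map (λ e → ℤ.+ term e ℚ./ n) (edges n))                  ≡⟨ sumℚ-map-/ m term (edges n) ⟩
    ℤ.+ sum (map term (edges n)) ℚ./ n                             ≡⟨ cong (λ a → ℤ.+ a ℚ./ n) sum-edges ⟩
    ℤ.+ ∑ n (λ v → ∑ d (λ j → W (suc j) * crossing s (suc j) v)) ℚ./ n
                                                                   ≡⟨ cong (λ a → ℤ.+ a ℚ./ n) by-lengths ⟩
    ℤ.+ ∑ d (λ j → W (suc j) * ∑ n (crossing s (suc j))) ℚ./ n     ∎
    where
    open ≡-Reasoning
    by-lengths : ∑ n (λ v → ∑ d (λ j → W (suc j) * crossing s (suc j) v)) ≡ ∑ d (λ j → W (suc j) * ∑ n (crossing s (suc j)))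
    by-lengths = trans (∑-swap n d (λ v j → W (suc j) * crossing s (suc j) v))
                       (∑-cong d (λ {j} _ → ∑-distribˡ-* n (W (suc j)) (crossing s (suc j))))

∑-weighted-≥ : ∀ m {c N} .{{_ : NonZero c}} (w C κ : ℕ → ℕ) → (∀ {j} → ¬ c ∣ κ j → N ≤ c * C j) →
               c ≤ ∑ m (λ j → w j * [ c ∤ κ j ]) → N ≤ ∑ m (λ j → w j * C j)
∑-weighted-≥ m {c} {N} w C κ N≤cC c≤∑ = *-cancelˡ-≤ c (begin
  c * N                                    ≡⟨ *-comm c N ⟩
  N * c                                    ≤⟨ *-monoʳ-≤ N c≤∑ ⟩
  N * ∑ m (λ j → w j * [ c ∤ κ j ])        ≡⟨ ∑-distribˡ-* m N _ ⟨
  ∑ m (λ j → N * (w j * [ c ∤ κ j ]))      ≤⟨ ∑-mono-≤ m (λ {j} _ → termwise j (c ∣? κ j)) ⟩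
  ∑ m (λ j → c * (w j * C j))              ≡⟨ ∑-distribˡ-* m c _ ⟩
  c * ∑ m (λ j → w j * C j)                ∎)
  where
  open ≤-Reasoning
  termwise : ∀ j → Dec (c ∣ κ j) → N * (w j * [ c ∤ κ j ]) ≤ c * (w j * C j)
  termwise j (yes c∣κ) = begin
    N * (w j * [ c ∤ κ j ])    ≡⟨ cong (λ x → N * (w j * x)) ([∤]≡0 c∣κ) ⟩
    N * (w j * 0)              ≡⟨ trans (cong (N *_) (*-zeroʳ (w j))) (*-zeroʳ N) ⟩
    0                          ≤⟨ z≤n ⟩
    c * (w j * C j)            ∎
  termwise j (no c∤κ) = begin
    N * (w j * [ c ∤ κ j ])    ≡⟨ cong (λ x → N * (w j * x)) ([∤]≡1 c∤κ) ⟩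
    N * (w j * 1)              ≡⟨ trans (cong (N *_) (*-identityʳ (w j))) (*-comm N (w j)) ⟩
    w j * N                    ≤⟨ *-monoʳ-≤ (w j) (N≤cC c∤κ) ⟩
    w j * (c * C j)            ≡⟨ trans (sym (*-assoc (w j) c (C j))) (trans (cong (_* C j) (*-comm (w j) c)) (*-assoc c (w j) (C j))) ⟩
    c * (w j * C j)            ∎

module _ {d} (φ : ℕ → ℕ) (φ-range : ∀ i → 1 ≤ i → i ≤ d → 1 ≤ φ i × φ i ≤ d)
         (φ-inj : ∀ i j → 1 ≤ i → i ≤ d → 1 ≤ j → j ≤ d → φ i ≡ φ j → i ≡ j) where

  private
    ψ : ℕ → ℕ
    ψ j = φ (suc j) ∸ 1

    suc-ψ : ∀ {j} → j < d → suc (ψ j) ≡ φ (suc j)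
    suc-ψ j<d = m+[n∸m]≡n (proj₁ (φ-range _ z<s j<d))

    ψ-into : MapsInto d ψ
    ψ-into j<d = subst (_≤ _) (sym (suc-ψ j<d)) (proj₂ (φ-range _ z<s j<d))

    ψ-inj : InjectiveOn d ψ
    ψ-inj i<d j<d ψi≡ψj = suc-injective (φ-inj _ _ z<s i<d z<s j<d (trans (sym (suc-ψ i<d)) (trans (cong suc ψi≡ψj) (suc-ψ j<d))))

  ∑-φ-≤ : ∀ h → ∑ d (λ j → h (φ (suc j))) ≤ ∑ d (λ j → h (suc j))
  ∑-φ-≤ h = subst (_≤ _) (∑-cong d (λ j<d → cong h (suc-ψ j<d))) (∑-reindex-≤ d ψ (h ∘ suc) ψ-into ψ-inj)

  findIdx-φ : ∀ {i} → 1 ≤ i → i ≤ d → findIdx φ (φ i) (range1 d) ≡ i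
  findIdx-φ {suc i} _ i<d = findIdx-unique φ (range1 d) (∈-map⁺ suc (∈-upTo⁺ i<d)) unique
    where
    unique : ∀ {j} → j ∈ range1 d → φ j ≡ φ (suc i) → j ≡ suc i
    unique j∈ φj≡φi with ∈-map⁻ suc j∈
    ... | j′ , j′∈ , refl = φ-inj _ _ z<s (∈-upTo⁻ j′∈) z<s i<d φj≡φi

  φ-hits-1 : 0 < d → ∃[ i ] 1 ≤ i × i ≤ d × φ i ≡ 1
  φ-hits-1 0<d with j , j<d , ψj≡0 ← injective⇒surjective d ψ ψ-into ψ-inj 0<d =
    suc j , z<s , j<d , trans (sym (suc-ψ j<d)) (cong suc ψj≡0)

inside-witness : ∀ {k} (p : Subset k) → 0 < ∣ p ∣ → ∃[ v ] lookup p v ≡ true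
inside-witness (true  ∷ p) _       = Fin.zero , refl
inside-witness (false ∷ p) 0<∣p∣ with v , p[v] ← inside-witness p 0<∣p∣ = Fin.suc v , p[v]

outside-witness : ∀ {k} (p : Subset k) → ∣ p ∣ < k → ∃[ v ] lookup p v ≡ false
outside-witness (false ∷ p) _ = Fin.zero , refl
outside-witness (true  ∷ p) (s<s ∣p∣<k) with v , p[v] ← outside-witness p ∣p∣<k = Fin.suc v , p[v]

module _ (m : ℕ) (φ : ℕ → ℕ)
  (φ-range : ∀ i → 1 ≤ i → i ≤ half (suc m) → 1 ≤ φ i × φ i ≤ half (suc m))
  (φ-inj : ∀ i j → 1 ≤ i → i ≤ half (suc m) → 1 ≤ j → j ≤ half (suc m) → φ i ≡ φ j → i ≡ j)
  (0<d : 0 < half (suc m))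
  (L : ℕ) (g[ℓ]≡1 : gseq (suc m) φ (suc L) ≡ 1) (g≢1 : ∀ i → i < suc L → gseq (suc m) φ i ≢ 1)
  (S : Subset (suc m)) {v₁ v₀ : Fin (suc m)} (v₁∈S : lookup S v₁ ≡ true) (v₀∉S : lookup S v₀ ≡ false) where

  private
    n d ℓ : ℕ
    n = suc m
    d = half n
    ℓ = suc L
    s : ℕ → Bool
    s = member n S
    W : ℕ → ℕ
    W = lengthWeight n φ ℓ

  ℓ≤d : ℓ ≤ d
  ℓ≤d with suc i , _ , i<d , φi≡1 ← φ-hits-1 φ φ-range φ-inj 0<d = ≤-trans (≮⇒≥ ℓ≰i) i<d
    where
    ℓ≰i : ¬ suc i < ℓ
    ℓ≰i i<ℓ = g≢1 (suc i) i<ℓ (trans (cong (λ a → gcd a (gseq n φ i)) φi≡1) (gcd-zeroˡ (gseq n φ i)))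

  xδ≥2 : (1ℚ +ℚ 1ℚ) ≤ℚ xδ n φ ℓ S
  xδ≥2 with c , 0<c , c-period , c∣period ← fundamental-period Bool._≟_ (member-periodic S) =
    subst ((1ℚ +ℚ 1ℚ) ≤ℚ_) (sym (xδ≡∑/n m φ ℓ S))
      (2≤/ m (∑-weighted-≥ d (W ∘ suc) (λ j → ∑ n (crossing s (suc j))) suc crossings-bound c≤∑))
    where
    instance
      c≢0 : NonZero c
      c≢0 = >-nonZero 0<c
    c∣n : c ∣ n
    c∣n = c∣period (member-periodic S)
    s[v₁]≢s[v₀] : s (toℕ v₁) ≢ s (toℕ v₀)
    s[v₁]≢s[v₀] eq with () ← trans (sym (trans (member-toℕ S v₁) v₁∈S)) (trans eq (trans (member-toℕ S v₀) v₀∉S))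
    2≤c : 2 ≤ c
    2≤c = nonconstant⇒2≤period (toℕ v₁) (toℕ v₀) c-period 0<c s[v₁]≢s[v₀]
    crossings-bound : ∀ {j} → ¬ c ∣ suc j → 2 * n ≤ c * ∑ n (crossing s (suc j))
    crossings-bound c∤k = crossings-≥ c-period c∣n (c∤k ∘ c∣period)
    c≤∑ : c ≤ ∑ d (λ j → W (suc j) * [ c ∤ suc j ])
    c≤∑ = begin
      c                                                       ≤⟨ chain-bound φ z<s 2≤c c∣n L g[ℓ]≡1 (g≢1 L ≤-refl) ⟩
      ∑ ℓ (λ j → weight n φ ℓ (suc j) * [ c ∤ φ (suc j) ])    ≤⟨ ∑-prefix-≤ _ ℓ≤d ⟩
      ∑ d (λ j → weight n φ ℓ (suc j) * [ c ∤ φ (suc j) ])    ≡⟨ ∑-cong d (λ j<d → cong (λ i → weight n φ ℓ i * _)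
                                                                   (findIdx-φ φ φ-range φ-inj z<s j<d)) ⟨
      ∑ d (λ j → W (φ (suc j)) * [ c ∤ φ (suc j) ])           ≤⟨ ∑-φ-≤ φ φ-range φ-inj (λ k → W k * [ c ∤ k ]) ⟩
      ∑ d (λ j → W (suc j) * [ c ∤ suc j ])                   ∎
      where open ≤-Reasoning

proposition4 : (n : ℕ) → .{{_ : NonZero n}} → 3 ≤ n →
    (c : ℕ → ℚ) → (φ : ℕ → ℕ) →
    (∀ i → 1 ≤ i → i ≤ half n → 1 ≤ φ i × φ i ≤ half n) →
    (∀ i j → 1 ≤ i → i ≤ half n → 1 ≤ j → j ≤ half n → φ i ≡ φ j → i ≡ j) →
    (∀ i → 1 ≤ i → i < half n → c (φ i) ≤ℚ c (φ (suc i))) →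
    (ℓ : ℕ) → gseq n φ ℓ ≡ 1 → (∀ i → i < ℓ → gseq n φ i ≢ 1) →
    (∀ i → i < ℓ → gseq n φ (suc i) < gseq n φ i) →
    (S : Subset n) → 2 ≤ ∣ S ∣ → ∣ S ∣ ≤ n ∸ 2 →
    (1ℚ +ℚ 1ℚ) ≤ℚ xδ n φ ℓ S
proposition4 _ (s≤s (s≤s (s≤s _))) _ φ _ _ _ zero g[0]≡1 _ _ _ _ _ = contradiction g[0]≡1 λ ()
proposition4 (suc m) (s≤s (s≤s (s≤s _))) _ φ φ-range φ-inj _ (suc L) g[ℓ]≡1 g≢1 _ S 2≤∣S∣ ∣S∣≤n∸2 =
  xδ≥2 m φ φ-range φ-inj z<s L g[ℓ]≡1 g≢1 S
    (proj₂ (inside-witness S (≤-trans (s≤s z≤n) 2≤∣S∣)))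
    (proj₂ (outside-witness S (≤-trans (s≤s ∣S∣≤n∸2) (n≤1+n m))))
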